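{- For every integer $d \geq 5$, the complete bipartite graph $K_{3,d}$ satisfies $\chi'_{st}(K_{3,d}) = 3\left\lceil \frac{d}{2} \right\rceil$.
   Context: A star edge coloring of a graph is a proper edge coloring in which there is no path or cycle of length four (i.e., with four edges) whose edges use only two colors. The star chromatic index $\chi'_{st}(G)$ is the minimum number $t$ such that $G$ has a star edge coloring with $t$ colors. -}

module Defs where

open import Level using (Level; _⊔_; suc)
open import Data.Nat.Base using (ℕ; _≤_)
open import Data.Fin.Base using (Fin)
open import Data.Sum.Base using (_⊎_; inj₁; inj₂)
open import Data.Product.Base using (Σ; _×_; ∃₂)
open import Data.Unit.Base using (⊤)
open import Data.Empty using (⊥)
open import Relation.Nullary using (¬_)
open import Relation.Binary.PropositionalEquality using (_≡_; _≢_)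

record Graph : Set₁ where
  field
    V        : Set
    Adj      : V → V → Set
    Adj-sym  : ∀ {u v} → Adj u v → Adj v u
    Adj-irr  : ∀ {u} → ¬ Adj u u
open Graph public

-- An edge colouring with t colours: a colour for each unordered pair of
-- vertices (only the values on edges matter); symmetric so that it is a
-- function of the (unordered) edge.
record EdgeColoring (G : Graph) (t : ℕ) : Set where
  field
    col     : V G → V G → Fin t
    col-sym : ∀ u v → col u v ≡ col v u
open EdgeColoring public

Proper : (G : Graph) {t : ℕ} → EdgeColoring G t → Set
Proper G c = ∀ u v w → Adj G u v → Adj G u w → v ≢ w → col c u v ≢ col c u w

-- A path or cycle of length four (four edges): vertices v0 v1 v2 v3 v4 with
-- consecutive ones adjacent, v0 v1 v2 v3 pairwise distinct, v1 v2 v3 v4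
-- pairwise distinct (v4 = v0 allowed, giving a 4-cycle).
record Path4orCycle4 (G : Graph) : Set where
  field
    v0 v1 v2 v3 v4 : V G
    a01 : Adj G v0 v1
    a12 : Adj G v1 v2
    a23 : Adj G v2 v3
    a34 : Adj G v3 v4
    d02 : v0 ≢ v2
    d03 : v0 ≢ v3
    d13 : v1 ≢ v3
    d14 : v1 ≢ v4
    d24 : v2 ≢ v4
    -- (v0≢v1, v1≢v2, v2≢v3, v3≢v4 follow from irreflexivity of Adj)
open Path4orCycle4 public

Bicolored : (G : Graph) {t : ℕ} → EdgeColoring G t → Path4orCycle4 G → Set
Bicolored G c p = ∃₂ λ a b →
  In (col c (v0 p) (v1 p)) a b × In (col c (v1 p) (v2 p)) a b ×
  In (col c (v2 p) (v3 p)) a b × In (col c (v3 p) (v4 p)) a b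
  where
  In : ∀ {t} → Fin t → Fin t → Fin t → Set
  In x a b = (x ≡ a) ⊎ (x ≡ b)

StarEdgeColoring : (G : Graph) {t : ℕ} → EdgeColoring G t → Set
StarEdgeColoring G c = Proper G c × (∀ (p : Path4orCycle4 G) → ¬ Bicolored G c p)

StarChromaticIndexIs : Graph → ℕ → Set
StarChromaticIndexIs G k =
  (Σ (EdgeColoring G k) (StarEdgeColoring G)) ×
  (∀ t (c : EdgeColoring G t) → StarEdgeColoring G c → k ≤ t)

KAdj : (m n : ℕ) → Fin m ⊎ Fin n → Fin m ⊎ Fin n → Set
KAdj m n (inj₁ _) (inj₂ _) = ⊤
KAdj m n (inj₂ _) (inj₁ _) = ⊤
KAdj m n (inj₁ _) (inj₁ _) = ⊥
KAdj m n (inj₂ _) (inj₂ _) = ⊥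

K : ℕ → ℕ → Graph
K m n = record
  { V = Fin m ⊎ Fin n
  ; Adj = KAdj m n
  ; Adj-sym = sym'
  ; Adj-irr = irr
  }
  where
  sym' : ∀ {u v} → KAdj m n u v → KAdj m n v u
  sym' {inj₁ _} {inj₂ _} _ = _
  sym' {inj₂ _} {inj₁ _} _ = _
  irr : ∀ {u} → ¬ KAdj m n u u
  irr {inj₁ _} ()
  irr {inj₂ _} ()

-- Write M i b for the color of the edge aᵢ b of K_{3,d}; in a star
-- edge coloring each row of M consists of d distinct colors. A color common to
-- rows r and s sits in a column of row r and in a column of row s, and no column
-- b plays both roles: M r b = M s b₁ and M s b = M r b₂ would make the path
-- b₂ aᵣ b aₛ b₁ bicolored. So two rows share at most ⌊d/2⌋ colors, and by the
-- Bonferroni inequality at least 3d − 3⌊d/2⌋ = 3⌈d/2⌉ colors are used.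
--
-- With N = ⌈d/2⌉ ≥ 3, take the columns to be ℤ_N × {0,1} and give
-- the edge aᵢ (k , p) the color (i − p , k − p·i) ∈ ℤ₃ × ℤ_N. The first
-- coordinate already rules out bicolored paths with both ends among the b's;
-- for the others one needs that k, k − 1, k − 2 are distinct modulo N.
module Submission where

open import Defs
open import Algebra.Properties.CommutativeSemigroup using (xy∙z≈xz∙y)
open import Data.Empty using (⊥; ⊥-elim)
open import Data.Fin.Base using (Fin; zero; suc; toℕ; fromℕ; inject₁; inject≤; remQuot; combine)
open import Data.Fin.Properties
  using (_≟_; any?; ¬Fin0; suc-injective; injective⇒≤; +↔⊎; *↔×; inject≤-injective;
         fromℕ≢inject₁; inject₁-injective; toℕ-inject₁)
open import Data.Nat.Base using (ℕ; zero; suc; s≤s; _+_; _*_; _≤_; ⌊_/2⌋; ⌈_/2⌉)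
open import Data.Nat.Properties
  using (1+n≢n; m+1+n≢n; +-comm; +-mono-≤; +-monoˡ-≤; +-monoʳ-≤; +-cancelˡ-≤;
         +-commutativeSemigroup; ⌊n/2⌋-mono; n≡⌊n+n/2⌋; ⌊n/2⌋≤⌈n/2⌉; ⌊n/2⌋+⌈n/2⌉≡n;
         module ≤-Reasoning)
open import Data.Nat.Tactic.RingSolver using (solve-∀)
open import Data.Product.Base using (_×_; _,_; ∃; proj₁; proj₂; uncurry)
open import Data.Product.Properties using (,-injectiveˡ; ,-injectiveʳ)
open import Data.Sum.Base using (_⊎_; inj₁; inj₂)
open import Data.Sum.Properties using (inj₁-injective; inj₂-injective)
open import Data.Unit.Base using (tt)
open import Function.Base using (_∘_; id)
open import Function.Bundles using (_↔_; Inverse; Injection)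
open import Function.Definitions using (Injective)
open import Function.Properties.Inverse using (↔-refl; ↔-sym; ↔⇒↣)
open import Level using (0ℓ)
open import Relation.Binary.PropositionalEquality
  using (_≡_; _≢_; refl; sym; trans; cong; subst; module ≡-Reasoning)
open import Relation.Nullary using (Dec; yes; no)
open import Relation.Nullary.Decidable using (decidable-stable)
open import Relation.Unary using (Pred; Decidable; _∪_; _∩_; _⊆_)
open import Relation.Unary.Properties using (_∪?_; _∩?_)

↔-to-injective : ∀ {A B : Set} (A↔B : A ↔ B) → Injective _≡_ _≡_ (Inverse.to A↔B)
↔-to-injective A↔B = Injection.injective (↔⇒↣ A↔B)

↔-injective⇒≤ : ∀ {A B : Set} {m n} → Fin m ↔ A → B ↔ Fin n →
                {f : A → B} → Injective _≡_ _≡_ f → m ≤ n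
↔-injective⇒≤ A↔ B↔ f-inj =
  injective⇒≤ λ eq → ↔-to-injective A↔ (f-inj (↔-to-injective B↔ eq))

record Enumeration {t : ℕ} (P : Pred (Fin t) 0ℓ) : Set where
  field
    size              : ℕ
    element           : Fin size → Fin t
    element∈          : ∀ i → P (element i)
    element-injective : Injective _≡_ _≡_ element
    index             : ∀ {α} → P α → Fin size
    element-index     : ∀ {α} (α∈P : P α) → element (index α∈P) ≡ α

  index-injective : ∀ {α β} {α∈P : P α} {β∈P : P β} → index α∈P ≡ index β∈P → α ≡ β
  index-injective {α∈P = α∈P} {β∈P} eq =
    trans (sym (element-index α∈P)) (trans (cong element eq) (element-index β∈P))

enumerate : ∀ {t} {P : Pred (Fin t) 0ℓ} → Decidable P → Enumeration P
enumerate {zero} P? = record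
  { size = 0 ; element = λ () ; element∈ = λ ()
  ; element-injective = λ {i} → ⊥-elim (¬Fin0 i)
  ; index = λ {α} → ⊥-elim (¬Fin0 α) ; element-index = λ {α} → ⊥-elim (¬Fin0 α)
  }
enumerate {suc t} {P} P? with P? zero
... | yes P0 = record
  { size = suc E.size ; element = element ; element∈ = element∈
  ; element-injective = element-injective ; index = index ; element-index = element-index
  }
  where
  module E = Enumeration (enumerate (P? ∘ suc))
  element : Fin (suc E.size) → Fin (suc t)
  element zero    = zero
  element (suc i) = suc (E.element i)
  element∈ : ∀ i → P (element i)
  element∈ zero    = P0
  element∈ (suc i) = E.element∈ i
  element-injective : Injective _≡_ _≡_ element
  element-injective {zero}  {zero}  _  = refl
  element-injective {suc _} {suc _} eq = cong suc (E.element-injective (suc-injective eq))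
  index : ∀ {α} → P α → Fin (suc E.size)
  index {zero}  _   = zero
  index {suc _} α∈P = suc (E.index α∈P)
  element-index : ∀ {α} (α∈P : P α) → element (index α∈P) ≡ α
  element-index {zero}  _   = refl
  element-index {suc _} α∈P = cong suc (E.element-index α∈P)
... | no ¬P0 = record
  { size = E.size ; element = suc ∘ E.element ; element∈ = E.element∈
  ; element-injective = E.element-injective ∘ suc-injective
  ; index = index ; element-index = element-index
  }
  where
  module E = Enumeration (enumerate (P? ∘ suc))
  index : ∀ {α} → P α → Fin E.size
  index {zero}  P0  = ⊥-elim (¬P0 P0)
  index {suc _} α∈P = E.index α∈P
  element-index : ∀ {α} (α∈P : P α) → suc (E.element (index α∈P)) ≡ α
  element-index {zero}  P0  = ⊥-elim (¬P0 P0)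
  element-index {suc _} α∈P = cong suc (E.element-index α∈P)

count : ∀ {t} {P : Pred (Fin t) 0ℓ} → Decidable P → ℕ
count P? = Enumeration.size (enumerate P?)

module _ {t : ℕ} {P : Pred (Fin t) 0ℓ} (P? : Decidable P) where
  open Enumeration (enumerate P?)

  count≤n : count P? ≤ t
  count≤n = injective⇒≤ element-injective

  injective⇒≤count : ∀ {n} {f : Fin n → Fin t} →
                     Injective _≡_ _≡_ f → (∀ i → P (f i)) → n ≤ count P?
  injective⇒≤count f-inj f∈P = injective⇒≤ {f = index ∘ f∈P} (f-inj ∘ index-injective)

module _ {t : ℕ} {P Q : Pred (Fin t) 0ℓ} (P? : Decidable P) (Q? : Decidable Q) where
  private
    module EP = Enumeration (enumerate P?)
    module EQ = Enumeration (enumerate Q?)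
    module EU = Enumeration (enumerate (P? ∪? Q?))

  count∪≤count+count : count (P? ∪? Q?) ≤ count P? + count Q?
  count∪≤count+count =
    ↔-injective⇒≤ ↔-refl (↔-sym +↔⊎) {f = side ∘ EU.element∈}
      λ eq → EU.element-injective (side-injective _ _ eq)
    where
    side : ∀ {α} → (P ∪ Q) α → Fin (count P?) ⊎ Fin (count Q?)
    side (inj₁ α∈P) = inj₁ (EP.index α∈P)
    side (inj₂ α∈Q) = inj₂ (EQ.index α∈Q)
    side-injective : ∀ {α β} (α∈ : (P ∪ Q) α) (β∈ : (P ∪ Q) β) →
                     side α∈ ≡ side β∈ → α ≡ β
    side-injective (inj₁ _) (inj₁ _) eq = EP.index-injective (inj₁-injective eq)
    side-injective (inj₂ _) (inj₂ _) eq = EQ.index-injective (inj₂-injective eq)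

  count+count≤count∪+count : ∀ {R : Pred (Fin t) 0ℓ} (R? : Decidable R) → P ∩ Q ⊆ R →
                             count P? + count Q? ≤ count (P? ∪? Q?) + count R?
  count+count≤count∪+count R? P∩Q⊆R = ↔-injective⇒≤ +↔⊎ (↔-sym +↔⊎) place-injective
    where
    module ER = Enumeration (enumerate R?)
    placeQ : ∀ j → Dec (P (EQ.element j)) → Fin (count (P? ∪? Q?)) ⊎ Fin (count R?)
    placeQ j (yes α∈P) = inj₂ (ER.index (P∩Q⊆R (α∈P , EQ.element∈ j)))
    placeQ j (no _)    = inj₁ (EU.index (inj₂ (EQ.element∈ j)))
    place : Fin (count P?) ⊎ Fin (count Q?) → Fin (count (P? ∪? Q?)) ⊎ Fin (count R?)
    place (inj₁ i) = inj₁ (EU.index (inj₁ (EP.element∈ i)))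
    place (inj₂ j) = placeQ j (P? (EQ.element j))
    placeQ-injective : ∀ j j′ D D′ → placeQ j D ≡ placeQ j′ D′ → j ≡ j′
    placeQ-injective _ _ (yes _) (yes _) eq = EQ.element-injective (ER.index-injective (inj₂-injective eq))
    placeQ-injective _ _ (no _)  (no _)  eq = EQ.element-injective (EU.index-injective (inj₁-injective eq))
    placeQ-injective _ _ (yes _) (no _)  ()
    placeQ-injective _ _ (no _)  (yes _) ()
    placeP≢placeQ : ∀ i j D → place (inj₁ i) ≢ placeQ j D
    placeP≢placeQ i j (no α∉P) eq = α∉P (subst P (EU.index-injective (inj₁-injective eq)) (EP.element∈ i))
    place-injective : Injective _≡_ _≡_ place
    place-injective {inj₁ _} {inj₁ _} eq =
      cong inj₁ (EP.element-injective (EU.index-injective (inj₁-injective eq)))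
    place-injective {inj₂ j} {inj₂ j′} eq = cong inj₂ (placeQ-injective j j′ _ _ eq)
    place-injective {inj₁ i} {inj₂ j}  eq = ⊥-elim (placeP≢placeQ i j _ eq)
    place-injective {inj₂ j} {inj₁ i}  eq = ⊥-elim (placeP≢placeQ i j _ (sym eq))

bonferroni₃ : ∀ {t} {P Q S : Pred (Fin t) 0ℓ} (P? : Decidable P) (Q? : Decidable Q) (S? : Decidable S) →
              count P? + count Q? + count S? ≤
              count ((P? ∪? Q?) ∪? S?) + (count (P? ∩? Q?) + count (P? ∩? S?) + count (Q? ∩? S?))
bonferroni₃ {P = P} {Q} {S} P? Q? S? = begin
  count P? + count Q? + count S?
    ≤⟨ +-monoˡ-≤ (count S?) (count+count≤count∪+count P? Q? (P? ∩? Q?) id) ⟩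
  count (P? ∪? Q?) + count (P? ∩? Q?) + count S?
    ≡⟨ xy∙z≈xz∙y +-commutativeSemigroup (count (P? ∪? Q?)) (count (P? ∩? Q?)) (count S?) ⟩
  count (P? ∪? Q?) + count S? + count (P? ∩? Q?)
    ≤⟨ +-monoˡ-≤ (count (P? ∩? Q?)) (count+count≤count∪+count (P? ∪? Q?) S? PS∪QS? distribute) ⟩
  count ((P? ∪? Q?) ∪? S?) + count PS∪QS? + count (P? ∩? Q?)
    ≤⟨ +-monoˡ-≤ (count (P? ∩? Q?))
         (+-monoʳ-≤ (count ((P? ∪? Q?) ∪? S?)) (count∪≤count+count (P? ∩? S?) (Q? ∩? S?))) ⟩
  count ((P? ∪? Q?) ∪? S?) + (count (P? ∩? S?) + count (Q? ∩? S?)) + count (P? ∩? Q?)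
    ≡⟨ rearrange (count ((P? ∪? Q?) ∪? S?)) (count (P? ∩? Q?)) (count (P? ∩? S?)) (count (Q? ∩? S?)) ⟩
  count ((P? ∪? Q?) ∪? S?) + (count (P? ∩? Q?) + count (P? ∩? S?) + count (Q? ∩? S?)) ∎
  where
  open ≤-Reasoning
  PS∪QS? : Decidable ((P ∩ S) ∪ (Q ∩ S))
  PS∪QS? = P? ∩? S? ∪? Q? ∩? S?
  distribute : (P ∪ Q) ∩ S ⊆ (P ∩ S) ∪ (Q ∩ S)
  distribute (inj₁ α∈P , α∈S) = inj₁ (α∈P , α∈S)
  distribute (inj₂ α∈Q , α∈S) = inj₂ (α∈Q , α∈S)
  rearrange : ∀ w a b c → w + (b + c) + a ≡ w + (a + b + c)
  rearrange = solve-∀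

≢-same⇒≡ : ∀ {A : Set} {a b x y z : A} →
           (x ≡ a) ⊎ (x ≡ b) → (y ≡ a) ⊎ (y ≡ b) → (z ≡ a) ⊎ (z ≡ b) →
           x ≢ y → z ≢ y → x ≡ z
≢-same⇒≡ (inj₁ x≡a) (inj₁ y≡a) _          x≢y _   = ⊥-elim (x≢y (trans x≡a (sym y≡a)))
≢-same⇒≡ (inj₂ x≡b) (inj₂ y≡b) _          x≢y _   = ⊥-elim (x≢y (trans x≡b (sym y≡b)))
≢-same⇒≡ _          (inj₁ y≡a) (inj₁ z≡a) _   z≢y = ⊥-elim (z≢y (trans z≡a (sym y≡a)))
≢-same⇒≡ _          (inj₂ y≡b) (inj₂ z≡b) _   z≢y = ⊥-elim (z≢y (trans z≡b (sym y≡b)))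
≢-same⇒≡ (inj₁ x≡a) (inj₂ _)   (inj₁ z≡a) _   _   = trans x≡a (sym z≡a)
≢-same⇒≡ (inj₂ x≡b) (inj₁ _)   (inj₂ z≡b) _   _   = trans x≡b (sym z≡b)

module _ {G : Graph} {t} {c : EdgeColoring G t} (proper : Proper G c) where

  proper⇒consecutive≢ : ∀ {u v w} → Adj G u v → Adj G v w → u ≢ w → col c u v ≢ col c v w
  proper⇒consecutive≢ {u} {v} {w} uv vw u≢w eq =
    proper v u w (Adj-sym G uv) vw u≢w (trans (col-sym c v u) eq)

  bicolored⇒alternating : (p : Path4orCycle4 G) → Bicolored G c p →
                           col c (v0 p) (v1 p) ≡ col c (v2 p) (v3 p) ×
                           col c (v1 p) (v2 p) ≡ col c (v3 p) (v4 p)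
  bicolored⇒alternating p (_ , _ , c₀₁ , c₁₂ , c₂₃ , c₃₄) =
    ≢-same⇒≡ c₀₁ c₁₂ c₂₃ ≢₀₁₂ (≢₁₂₃ ∘ sym) ,
    ≢-same⇒≡ c₁₂ c₂₃ c₃₄ ≢₁₂₃ (≢₂₃₄ ∘ sym)
    where
    ≢₀₁₂ = proper⇒consecutive≢ (a01 p) (a12 p) (d02 p)
    ≢₁₂₃ = proper⇒consecutive≢ (a12 p) (a23 p) (d13 p)
    ≢₂₃₄ = proper⇒consecutive≢ (a23 p) (a34 p) (d24 p)

module _ {R C A : Set} (M : R → C → A) where

  RowInjective : Set
  RowInjective = ∀ i → Injective _≡_ _≡_ (M i)

  ColumnInjective : Set
  ColumnInjective = ∀ b → Injective _≡_ _≡_ (λ i → M i b)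

  -- Bicolored paths a b a′ b′ a″ and b₁ r b s b₂ of the complete bipartite
  -- graph on R ⊎ C colored by M; their two ends may coincide.
  NoBicoloredPath₁ : Set
  NoBicoloredPath₁ = ∀ {a a′ a″} b b′ → a ≢ a′ → a′ ≢ a″ →
                      M a b ≡ M a′ b′ → M a′ b ≡ M a″ b′ → ⊥

  NoBicoloredPath₂ : Set
  NoBicoloredPath₂ = ∀ {r s} b₁ b b₂ → r ≢ s →
                      M r b₁ ≡ M s b → M r b ≡ M s b₂ → ⊥

  record IsStarMatrix : Set where
    field
      rowInjective      : RowInjective
      columnInjective   : ColumnInjective
      noBicoloredPath₁ : NoBicoloredPath₁
      noBicoloredPath₂ : NoBicoloredPath₂

isStarMatrix-relabel : ∀ {R C C′ A A′ : Set} {M : R → C → A} {e : C′ → C} {f : A → A′} →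
                       Injective _≡_ _≡_ e → Injective _≡_ _≡_ f →
                       IsStarMatrix M → IsStarMatrix (λ i b → f (M i (e b)))
isStarMatrix-relabel {e = e} e-inj f-inj star = record
  { rowInjective      = λ i → e-inj ∘ rowInjective i ∘ f-inj
  ; columnInjective   = λ b → columnInjective (e b) ∘ f-inj
  ; noBicoloredPath₁ = λ b b′ a≢a′ a′≢a″ eq eq′ →
      noBicoloredPath₁ (e b) (e b′) a≢a′ a′≢a″ (f-inj eq) (f-inj eq′)
  ; noBicoloredPath₂ = λ b₁ b b₂ r≢s eq eq′ →
      noBicoloredPath₂ (e b₁) (e b) (e b₂) r≢s (f-inj eq) (f-inj eq′)
  }
  where open IsStarMatrix star

entries : ∀ {m n t} → EdgeColoring (K m n) t → Fin m → Fin n → Fin t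
entries c i b = col c (inj₁ i) (inj₂ b)

module _ {m n t} {c : EdgeColoring (K m n) t} where

  proper⇒rowInjective : Proper (K m n) c → RowInjective (entries c)
  proper⇒rowInjective proper i {b} {b′} eq = decidable-stable (b ≟ b′) λ b≢b′ →
    proper (inj₁ i) (inj₂ b) (inj₂ b′) tt tt (b≢b′ ∘ inj₂-injective) eq

  proper⇒columnInjective : Proper (K m n) c → ColumnInjective (entries c)
  proper⇒columnInjective proper b {i} {j} eq = decidable-stable (i ≟ j) λ i≢j →
    proper (inj₂ b) (inj₁ i) (inj₁ j) tt tt (i≢j ∘ inj₁-injective)
      (trans (col-sym c (inj₂ b) (inj₁ i)) (trans eq (col-sym c (inj₁ j) (inj₂ b))))

  star⇒noBicoloredPath₂ : StarEdgeColoring (K m n) c → NoBicoloredPath₂ (entries c)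
  star⇒noBicoloredPath₂ (proper , noBicolored) {r} {s} b₁ b b₂ r≢s eq eq′ =
    noBicolored path
      ( entries c r b₁ , entries c r b
      , inj₁ (col-sym c (inj₂ b₁) (inj₁ r)) , inj₂ refl
      , inj₁ (trans (col-sym c (inj₂ b) (inj₁ s)) (sym eq)) , inj₂ (sym eq′))
    where
    columnInjective = proper⇒columnInjective proper
    path : Path4orCycle4 (K m n)
    path = record
      { v0 = inj₂ b₁ ; v1 = inj₁ r ; v2 = inj₂ b ; v3 = inj₁ s ; v4 = inj₂ b₂
      ; a01 = tt ; a12 = tt ; a23 = tt ; a34 = tt
      ; d02 = λ { refl → r≢s (columnInjective b eq) }
      ; d03 = λ ()
      ; d13 = r≢s ∘ inj₁-injective
      ; d14 = λ ()
      ; d24 = λ { refl → r≢s (columnInjective b eq′) }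
      }

module _ {m n t} (M : Fin m → Fin n → Fin t) (default : Fin t) where

  matrixColor : Fin m ⊎ Fin n → Fin m ⊎ Fin n → Fin t
  matrixColor (inj₁ i) (inj₂ b) = M i b
  matrixColor (inj₂ b) (inj₁ i) = M i b
  matrixColor (inj₁ _) (inj₁ _) = default
  matrixColor (inj₂ _) (inj₂ _) = default

  matrixColoring : EdgeColoring (K m n) t
  matrixColoring = record { col = matrixColor ; col-sym = symmetric }
    where
    symmetric : ∀ u v → matrixColor u v ≡ matrixColor v u
    symmetric (inj₁ _) (inj₂ _) = refl
    symmetric (inj₂ _) (inj₁ _) = refl
    symmetric (inj₁ _) (inj₁ _) = refl
    symmetric (inj₂ _) (inj₂ _) = refl

  isStarMatrix⇒star : IsStarMatrix M → StarEdgeColoring (K m n) matrixColoring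
  isStarMatrix⇒star star = proper , λ p bicolored →
    let eq , eq′ = bicolored⇒alternating {c = matrixColoring} proper p bicolored
    in noAlternation (v0 p) (v1 p) (v2 p) (v3 p) (v4 p)
         (a01 p) (a12 p) (a23 p) (a34 p) (d02 p) (d13 p) (d24 p) eq eq′
    where
    open IsStarMatrix star
    proper : Proper (K m n) matrixColoring
    proper (inj₁ i) (inj₂ b) (inj₂ b′) _ _ b≢b′ eq = b≢b′ (cong inj₂ (rowInjective i eq))
    proper (inj₂ b) (inj₁ i) (inj₁ j) _ _ i≢j eq = i≢j (cong inj₁ (columnInjective b eq))
    noAlternation : ∀ x₀ x₁ x₂ x₃ x₄ →
                    KAdj m n x₀ x₁ → KAdj m n x₁ x₂ → KAdj m n x₂ x₃ → KAdj m n x₃ x₄ →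
                    x₀ ≢ x₂ → x₁ ≢ x₃ → x₂ ≢ x₄ →
                    matrixColor x₀ x₁ ≡ matrixColor x₂ x₃ →
                    matrixColor x₁ x₂ ≡ matrixColor x₃ x₄ → ⊥
    noAlternation (inj₁ _) (inj₂ b) (inj₁ _) (inj₂ b′) (inj₁ _) _ _ _ _ a≢a′ _ a′≢a″ =
      noBicoloredPath₁ b b′ (a≢a′ ∘ cong inj₁) (a′≢a″ ∘ cong inj₁)
    noAlternation (inj₂ b₁) (inj₁ _) (inj₂ b) (inj₁ _) (inj₂ b₂) _ _ _ _ _ r≢s _ =
      noBicoloredPath₂ b₁ b b₂ (r≢s ∘ cong inj₁)
    noAlternation (inj₁ _) (inj₁ _) _ _ _ () _ _ _
    noAlternation (inj₂ _) (inj₂ _) _ _ _ () _ _ _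
    noAlternation _ (inj₁ _) (inj₁ _) _ _ _ () _ _
    noAlternation _ (inj₂ _) (inj₂ _) _ _ _ () _ _
    noAlternation _ _ (inj₁ _) (inj₁ _) _ _ _ () _
    noAlternation _ _ (inj₂ _) (inj₂ _) _ _ _ () _
    noAlternation _ _ _ (inj₁ _) (inj₁ _) _ _ _ ()
    noAlternation _ _ _ (inj₂ _) (inj₂ _) _ _ _ ()

module _ {m d t} (M : Fin m → Fin d → Fin t) where

  Row : Fin m → Pred (Fin t) 0ℓ
  Row i α = ∃ λ b → M i b ≡ α

  Row? : ∀ i → Decidable (Row i)
  Row? i α = any? λ b → M i b ≟ α

  rowInjective⇒d≤count : RowInjective M → ∀ i → d ≤ count (Row? i)
  rowInjective⇒d≤count rowInjective i = injective⇒≤count (Row? i) (rowInjective i) (λ b → b , refl)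

  noBicoloredPath₂⇒count∩≤⌊d/2⌋ : NoBicoloredPath₂ M → ∀ {r s} → r ≢ s →
                                   count (Row? r ∩? Row? s) ≤ ⌊ d /2⌋
  noBicoloredPath₂⇒count∩≤⌊d/2⌋ noPath {r} {s} r≢s =
    k+k≤d⇒k≤⌊d/2⌋ (↔-injective⇒≤ +↔⊎ ↔-refl {f = column} column-injective)
    where
    open Enumeration (enumerate (Row? r ∩? Row? s))
    column : Fin size ⊎ Fin size → Fin d
    column (inj₁ i) = proj₁ (proj₁ (element∈ i))
    column (inj₂ i) = proj₁ (proj₂ (element∈ i))
    sameColumn⇒≡ : ∀ {i α β} (p : Row i α) (q : Row i β) → proj₁ p ≡ proj₁ q → α ≡ β
    sameColumn⇒≡ (_ , refl) (_ , refl) refl = refl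
    distinctColumns : ∀ {α β} (α∈ : (Row r ∩ Row s) α) (β∈ : (Row r ∩ Row s) β) →
                      proj₁ (proj₁ α∈) ≢ proj₁ (proj₂ β∈)
    distinctColumns ((b , refl) , (b₁ , Msb₁≡Mrb)) ((b₂ , Mrb₂≡Msb) , (_ , refl)) refl =
      noPath b₂ b b₁ r≢s Mrb₂≡Msb (sym Msb₁≡Mrb)
    column-injective : Injective _≡_ _≡_ column
    column-injective {inj₁ i} {inj₁ j} eq =
      cong inj₁ (element-injective (sameColumn⇒≡ (proj₁ (element∈ i)) (proj₁ (element∈ j)) eq))
    column-injective {inj₂ i} {inj₂ j} eq =
      cong inj₂ (element-injective (sameColumn⇒≡ (proj₂ (element∈ i)) (proj₂ (element∈ j)) eq))
    column-injective {inj₁ i} {inj₂ j} eq = ⊥-elim (distinctColumns (element∈ i) (element∈ j) eq)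
    column-injective {inj₂ i} {inj₁ j} eq = ⊥-elim (distinctColumns (element∈ j) (element∈ i) (sym eq))
    k+k≤d⇒k≤⌊d/2⌋ : ∀ {k} → k + k ≤ d → k ≤ ⌊ d /2⌋
    k+k≤d⇒k≤⌊d/2⌋ {k} k+k≤d = subst (_≤ ⌊ d /2⌋) (sym (n≡⌊n+n/2⌋ k)) (⌊n/2⌋-mono k+k≤d)

3d≤t+3⌊d/2⌋⇒3⌈d/2⌉≤t : ∀ d t → d + d + d ≤ t + (⌊ d /2⌋ + ⌊ d /2⌋ + ⌊ d /2⌋) →
                        3 * ⌈ d /2⌉ ≤ t
3d≤t+3⌊d/2⌋⇒3⌈d/2⌉≤t d t 3d≤ = +-cancelˡ-≤ (h + h + h) (3 * c) t (begin
  h + h + h + 3 * c           ≡⟨ regroup h c ⟩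
  (h + c) + (h + c) + (h + c) ≡⟨ cong (λ x → x + x + x) (⌊n/2⌋+⌈n/2⌉≡n d) ⟩
  d + d + d                   ≤⟨ 3d≤ ⟩
  t + (h + h + h)             ≡⟨ +-comm t (h + h + h) ⟩
  h + h + h + t               ∎)
  where
  open ≤-Reasoning
  h = ⌊ d /2⌋
  c = ⌈ d /2⌉
  regroup : ∀ h c → h + h + h + 3 * c ≡ (h + c) + (h + c) + (h + c)
  regroup = solve-∀

threeRows-lowerBound : ∀ {d t} (M : Fin 3 → Fin d → Fin t) →
                       RowInjective M → NoBicoloredPath₂ M → 3 * ⌈ d /2⌉ ≤ t
threeRows-lowerBound {d} {t} M rowInjective noPath = 3d≤t+3⌊d/2⌋⇒3⌈d/2⌉≤t d t (begin
  d + d + d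
    ≤⟨ +-mono-≤ (+-mono-≤ (rowSize zero) (rowSize one)) (rowSize two) ⟩
  count (Row? M zero) + count (Row? M one) + count (Row? M two)
    ≤⟨ bonferroni₃ (Row? M zero) (Row? M one) (Row? M two) ⟩
  count ((Row? M zero ∪? Row? M one) ∪? Row? M two) +
    (count (Row? M zero ∩? Row? M one) + count (Row? M zero ∩? Row? M two) + count (Row? M one ∩? Row? M two))
    ≤⟨ +-mono-≤ (count≤n ((Row? M zero ∪? Row? M one) ∪? Row? M two))
                (+-mono-≤ (+-mono-≤ (sharedColors (λ ())) (sharedColors (λ ()))) (sharedColors (λ ()))) ⟩
  t + (⌊ d /2⌋ + ⌊ d /2⌋ + ⌊ d /2⌋) ∎)
  where
  open ≤-Reasoning
  one two : Fin 3
  one = suc zero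
  two = suc (suc zero)
  rowSize = rowInjective⇒d≤count M rowInjective
  sharedColors = noBicoloredPath₂⇒count∩≤⌊d/2⌋ M noPath

rotate : ∀ {n} → Fin (suc n) → Fin (suc n)
rotate zero    = fromℕ _
rotate (suc k) = inject₁ k

rotate-injective : ∀ {n} → Injective _≡_ _≡_ (rotate {n})
rotate-injective {x = zero}  {zero}  _  = refl
rotate-injective {x = zero}  {suc _} eq = ⊥-elim (fromℕ≢inject₁ eq)
rotate-injective {x = suc _} {zero}  eq = ⊥-elim (fromℕ≢inject₁ (sym eq))
rotate-injective {x = suc _} {suc _} eq = cong suc (inject₁-injective eq)

rotate-fixedPointFree : ∀ {n} (k : Fin (2 + n)) → rotate k ≢ k
rotate-fixedPointFree zero    ()
rotate-fixedPointFree (suc k) eq = 1+n≢n (sym (trans (sym (toℕ-inject₁ k)) (cong toℕ eq)))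

rotate²-fixedPointFree : ∀ {n} (k : Fin (3 + n)) → rotate (rotate k) ≢ k
rotate²-fixedPointFree zero          ()
rotate²-fixedPointFree (suc zero)    ()
rotate²-fixedPointFree (suc (suc k)) eq = m+1+n≢n 1 (sym (begin
  toℕ k                     ≡⟨ sym (toℕ-inject₁ k) ⟩
  toℕ (inject₁ k)           ≡⟨ sym (toℕ-inject₁ (inject₁ k)) ⟩
  toℕ (inject₁ (inject₁ k)) ≡⟨ cong toℕ eq ⟩
  2 + toℕ k                 ∎))
  where open ≡-Reasoning

rotations : ∀ {n} → Fin 3 → Fin (3 + n) → Fin (3 + n)
rotations zero             = id
rotations (suc zero)       = rotate
rotations (suc (suc zero)) = rotate ∘ rotate

rotations-injective : ∀ {n} i → Injective _≡_ _≡_ (rotations {n} i)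
rotations-injective zero             = id
rotations-injective (suc zero)       = rotate-injective
rotations-injective (suc (suc zero)) = rotate-injective ∘ rotate-injective

rotations-distinct : ∀ {n} (k : Fin (3 + n)) → Injective _≡_ _≡_ (λ i → rotations i k)
rotations-distinct k {zero}           {zero}           _  = refl
rotations-distinct k {suc zero}       {suc zero}       _  = refl
rotations-distinct k {suc (suc zero)} {suc (suc zero)} _  = refl
rotations-distinct k {zero}           {suc zero}       eq = ⊥-elim (rotate-fixedPointFree k (sym eq))
rotations-distinct k {suc zero}       {zero}           eq = ⊥-elim (rotate-fixedPointFree k eq)
rotations-distinct k {zero}           {suc (suc zero)} eq = ⊥-elim (rotate²-fixedPointFree k (sym eq))
rotations-distinct k {suc (suc zero)} {zero}           eq = ⊥-elim (rotate²-fixedPointFree k eq)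
rotations-distinct k {suc zero}       {suc (suc zero)} eq =
  ⊥-elim (rotate-fixedPointFree k (sym (rotate-injective eq)))
rotations-distinct k {suc (suc zero)} {suc zero}       eq =
  ⊥-elim (rotate-fixedPointFree k (rotate-injective eq))

tilt : Fin 3 → Fin 2 → Fin 3
tilt i zero       = i
tilt i (suc zero) = rotate i

twist : ∀ {n} → Fin 3 → Fin 2 → Fin (3 + n) → Fin (3 + n)
twist i zero       = id
twist i (suc zero) = rotations i

tilt-noAlternation : ∀ {r s} p₁ p p₂ → r ≢ s → tilt r p₁ ≡ tilt s p → tilt r p ≡ tilt s p₂ → ⊥
tilt-noAlternation zero       zero       _          r≢s eq _   = r≢s eq
tilt-noAlternation (suc zero) zero       zero       r≢s _  eq′ = r≢s eq′
tilt-noAlternation (suc zero) (suc zero) zero       r≢s eq _   = r≢s (rotate-injective eq)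
tilt-noAlternation _          (suc zero) (suc zero) r≢s _  eq′ = r≢s (rotate-injective eq′)
tilt-noAlternation {r} (suc zero) zero (suc zero) _ eq eq′ =
  rotate²-fixedPointFree r (trans (cong rotate eq) (sym eq′))
tilt-noAlternation {r} zero (suc zero) zero _ eq eq′ =
  rotate²-fixedPointFree r (trans (cong rotate eq′) (sym eq))

-- rotate is k ↦ k − 1 modulo 3 + n, so this is (i , (k , p)) ↦ (i − p , k − p·i).
cyclicMatrix : ∀ {n} → Fin 3 → Fin (3 + n) × Fin 2 → Fin 3 × Fin (3 + n)
cyclicMatrix i (k , p) = tilt i p , twist i p k

cyclicMatrix-isStarMatrix : ∀ {n} → IsStarMatrix (cyclicMatrix {n})
cyclicMatrix-isStarMatrix = record
  { rowInjective      = rowInjective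
  ; columnInjective   = columnInjective
  ; noBicoloredPath₁ = noBicoloredPath₁
  ; noBicoloredPath₂ = λ (_ , p₁) (_ , p) (_ , p₂) r≢s eq eq′ →
      tilt-noAlternation p₁ p p₂ r≢s (,-injectiveˡ eq) (,-injectiveˡ eq′)
  }
  where
  rowInjective : RowInjective cyclicMatrix
  rowInjective i {_ , zero}     {_ , zero}     eq = cong (_, zero) (,-injectiveʳ eq)
  rowInjective i {_ , suc zero} {_ , suc zero} eq = cong (_, suc zero) (rotations-injective i (,-injectiveʳ eq))
  rowInjective i {_ , zero}     {_ , suc zero} eq = ⊥-elim (rotate-fixedPointFree i (sym (,-injectiveˡ eq)))
  rowInjective i {_ , suc zero} {_ , zero}     eq = ⊥-elim (rotate-fixedPointFree i (,-injectiveˡ eq))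
  columnInjective : ColumnInjective cyclicMatrix
  columnInjective (_ , zero)     = ,-injectiveˡ
  columnInjective (_ , suc zero) = rotate-injective ∘ ,-injectiveˡ
  noBicoloredPath₁ : NoBicoloredPath₁ cyclicMatrix
  noBicoloredPath₁ (_ , zero)     (_ , zero)      a≢a′ _ eq _ = a≢a′ (,-injectiveˡ eq)
  noBicoloredPath₁ (_ , suc zero) (_ , suc zero)  a≢a′ _ eq _ = a≢a′ (rotate-injective (,-injectiveˡ eq))
  noBicoloredPath₁ (_ , zero)     (k′ , suc zero) _ a′≢a″ eq eq′ =
    a′≢a″ (rotations-distinct k′ (trans (sym (,-injectiveʳ eq)) (,-injectiveʳ eq′)))
  noBicoloredPath₁ (k , suc zero) (_ , zero)      a≢a′ _ eq eq′ =
    a≢a′ (rotations-distinct k (trans (,-injectiveʳ eq) (sym (,-injectiveʳ eq′))))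

n≤⌈n/2⌉*2 : ∀ n → n ≤ ⌈ n /2⌉ * 2
n≤⌈n/2⌉*2 n = begin
  n                 ≡⟨ sym (⌊n/2⌋+⌈n/2⌉≡n n) ⟩
  ⌊ n /2⌋ + ⌈ n /2⌉ ≤⟨ +-monoˡ-≤ ⌈ n /2⌉ (⌊n/2⌋≤⌈n/2⌉ n) ⟩
  ⌈ n /2⌉ + ⌈ n /2⌉ ≡⟨ double ⌈ n /2⌉ ⟩
  ⌈ n /2⌉ * 2       ∎
  where
  open ≤-Reasoning
  double : ∀ c → c + c ≡ c * 2
  double = solve-∀

-- For d = 5 + d′ the number ⌈ d /2⌉ reduces to 3 + ⌊ d′ /2⌋, the form cyclicMatrix needs.
theorem3 : ∀ (d : ℕ) → 5 ≤ d → StarChromaticIndexIs (K 3 d) (3 * ⌈ d /2⌉)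
theorem3 d@(suc (suc (suc (suc (suc _))))) (s≤s (s≤s (s≤s (s≤s (s≤s _))))) =
  (matrixColoring M zero , isStarMatrix⇒star M zero M-isStarMatrix) ,
  λ t c star@(proper , _) →
    threeRows-lowerBound (entries c) (proper⇒rowInjective {c = c} proper)
                         (star⇒noBicoloredPath₂ {c = c} star)
  where
  column : Fin d → Fin ⌈ d /2⌉ × Fin 2
  column b = remQuot 2 (inject≤ b (n≤⌈n/2⌉*2 d))
  column-injective : Injective _≡_ _≡_ column
  column-injective = inject≤-injective _ _ _ _ ∘ ↔-to-injective *↔×
  M : Fin 3 → Fin d → Fin (3 * ⌈ d /2⌉)
  M i b = uncurry combine (cyclicMatrix i (column b))
  M-isStarMatrix : IsStarMatrix M
  M-isStarMatrix =
    isStarMatrix-relabel column-injective (↔-to-injective (↔-sym *↔×)) cyclicMatrix-isStarMatrix
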